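{- For all integers $k\ge2$ and $n\ge2$, $\mathsf{ACC}_k\not\le^*_{\mathrm W}(\mathsf{PHP}^{n^{k+1}+1}_n)'$.
   Context: A number $N\ge1$ is identified with $\{0,\dots,N-1\}$. Problems have instances and solutions coded as elements of Baire space $\mathbb N^{\mathbb N}$. $\mathsf{P}\le^*_{\mathrm W}\mathsf{Q}$ (continuous Weihrauch reducibility) if there are continuous partial maps $\Phi,\Psi$ on $\mathbb N^{\mathbb N}$ such that for every $\mathsf{P}$-instance $p$, $\Phi(p)$ is a $\mathsf{Q}$-instance and for every $\mathsf{Q}$-solution $q$ of $\Phi(p)$, $\Psi(p,q)$ is a $\mathsf{P}$-solution of $p$. For $m>n\ge2$, $(\mathsf{PHP}^m_n)'$ has as instances all pointwise convergent sequences $(f_s:m\to n)_{s\in\mathbb N}$, with solutions all unordered pairs $\{i,j\}$, $i\ne j$, with $\lim_s f_s(i)=\lim_s f_s(j)$. For $k\ge2$, $\mathsf{ACC}_k$ has as instances those $p\in\mathbb N^{\mathbb N}$ such that either there is a unique $\ell<k$ that appears in $p$ (then every $j<k$, $j\ne\ell$, is a solution), or $p$ is the constant sequence with value $k$ (then every $j<k$ is a solution). -}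

module Defs where

open import Data.Nat using (ℕ; zero; suc; _+_; _*_; _^_; _≤_; _<_)
open import Data.Product using (Σ; ∃; ∃-syntax; _×_; _,_)
open import Data.Sum using (_⊎_; inj₁; inj₂)
open import Relation.Binary.PropositionalEquality using (_≡_; _≢_)
open import Relation.Nullary using (¬_)

Baire : Set
Baire = ℕ → ℕ

Agree : ℕ → Baire → Baire → Set
Agree m p q = ∀ i → i < m → p i ≡ q i

record Problem : Set₁ where
  field
    Inst : Baire → Set
    Sol  : (p : Baire) → Inst p → Baire → Set
open Problem public

-- Continuous Weihrauch reducibility P ≤*W Q.
-- Φ is a partial map whose domain contains all P-instances; it is
-- given as a map on the instances and is required to be continuous there.
-- Ψ is a partial map on pairs (p , q) whose domain contains all
-- (p , q) with p a P-instance and q a Q-solution of Φ(p); it is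
-- required to be (jointly) continuous there.
record _≤W*_ (P Q : Problem) : Set where
  field
    Φ : (p : Baire) → Inst P p → Baire
    Φ-cont : ∀ p (hp : Inst P p) (n : ℕ) → ∃[ m ] (∀ p' (hp' : Inst P p') →
               Agree m p p' → Agree n (Φ p hp) (Φ p' hp'))
    Φ-inst : ∀ p (hp : Inst P p) → Inst Q (Φ p hp)
    Ψ : (p : Baire) (hp : Inst P p) (q : Baire) → Sol Q (Φ p hp) (Φ-inst p hp) q → Baire
    Ψ-cont : ∀ p (hp : Inst P p) q (hq : Sol Q (Φ p hp) (Φ-inst p hp) q) (n : ℕ) →
               ∃[ m ] (∀ p' (hp' : Inst P p') q' (hq' : Sol Q (Φ p' hp') (Φ-inst p' hp') q') →
                 Agree m p p' → Agree m q q' →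
                 Agree n (Ψ p hp q hq) (Ψ p' hp' q' hq'))
    Ψ-sol : ∀ p (hp : Inst P p) q (hq : Sol Q (Φ p hp) (Φ-inst p hp) q) →
              Sol P p hp (Ψ p hp q hq)

Appears : ℕ → Baire → Set
Appears ℓ p = ∃[ t ] p t ≡ ℓ

UniqueAppears : ℕ → Baire → ℕ → Set
UniqueAppears k p ℓ = ℓ < k × Appears ℓ p × (∀ j → j < k → Appears j p → j ≡ ℓ)

ACCInst : ℕ → Baire → Set
ACCInst k p = (∃[ ℓ ] UniqueAppears k p ℓ) ⊎ (∀ t → p t ≡ k)

-- A solution j < k is coded by any r ∈ Baire with r 0 = j.
ACCSol : (k : ℕ) (p : Baire) → ACCInst k p → Baire → Set
ACCSol k p (inj₁ (ℓ , _)) r = r 0 < k × r 0 ≢ ℓ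
ACCSol k p (inj₂ _)       r = r 0 < k

ACC : ℕ → Problem
ACC k = record { Inst = ACCInst k ; Sol = ACCSol k }

-- A sequence (f_s : m → n)_s is coded by p with p (s * m + i) = f_s i.
fseq : (m : ℕ) → Baire → ℕ → ℕ → ℕ
fseq m p s i = p (s * m + i)

LimIs : (m : ℕ) → Baire → ℕ → ℕ → Set
LimIs m p i v = ∃[ s₀ ] (∀ s → s₀ ≤ s → fseq m p s i ≡ v)

PHP'Inst : (m n : ℕ) → Baire → Set
PHP'Inst m n p =
  (∀ s i → i < m → fseq m p s i < n) ×
  (∀ i → i < m → ∃[ v ] LimIs m p i v)

-- The unordered pair {i , j} is coded by any r with {r 0 , r 1} = {i , j}
-- (both orders are accepted).
PHP'Sol : (m n : ℕ) (p : Baire) → PHP'Inst m n p → Baire → Set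
PHP'Sol m n p _ r =
  r 0 < m × r 1 < m × r 0 ≢ r 1 ×
  ∃[ v ] (LimIs m p (r 0) v × LimIs m p (r 1) v)

PHP' : ℕ → ℕ → Problem
PHP' m n = record { Inst = PHP'Inst m n ; Sol = PHP'Sol m n }

{-# OPTIONS --safe #-}
-- Let x₀ be the constant instance k of ACC_k. Only finitely many pairs {i , j} solve Φ(x₀), so
-- there is a stage M by which Ψ has read enough of x₀ to commit, on every such pair, to an answer
-- a < k. For a < k let x_a be k up to stage M and a afterwards. The limits of Φ(x₀) and of the
-- k sequences Φ(x_a) are k + 1 colourings of the m > n^(k+1) points with n colours, so some pair
-- {i , j} is monochromatic for all of them and solves every Φ(x_a). If Ψ answers a on (x₀, {i , j}),
-- it answers a on (x_a, {i , j}) too, but a is exactly the forbidden answer for x_a.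
module Submission where

open import Defs
open import Data.Nat using (ℕ; suc; _+_; _^_; _≤_)
open import Relation.Nullary using (¬_)

open import Data.Empty using (⊥)
open import Data.Fin using (Fin; zero; suc; toℕ; fromℕ<; combine)
open import Data.Fin.Properties
  using (toℕ<n; toℕ-fromℕ<; toℕ-injective; fromℕ<-injective; combine-injective; pigeonhole; <⇒≢)
  renaming (_≟_ to _≟ᶠ_)
open import Data.List using (tabulate)
open import Data.List.Extrema.Nat using (max; xs≤max)
import Data.List.Relation.Unary.All.Properties as All
open import Data.Nat using (zero; _<_; z<s)
open import Data.Nat.Properties using (_<?_; ≤-refl; ≤-trans; <-≤-trans; <-irrefl; m<m+n; +-comm)
open import Data.Product using (Σ; ∃₂; _×_; _,_; proj₁; proj₂)
open import Data.Sum using (inj₁; inj₂)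
open import Function using (_∘_; const)
open import Level using (0ℓ)
open import Relation.Binary.Core using (Rel)
open import Relation.Binary.Definitions using (Decidable)
open import Relation.Binary.PropositionalEquality using (_≡_; _≢_; refl; sym; trans; subst)
open import Relation.Nullary using (yes; no; contradiction; ¬?; _×-dec_)

Agree-≤ : ∀ {m m'} {p q : Baire} → m ≤ m' → Agree m' p q → Agree m p q
Agree-≤ m≤m' agree i i<m = agree i (<-≤-trans i<m m≤m')

-- Proofs of R i j need not be unique (R may involve negations), so the bounded witness is
-- the one produced by R?, not the given one.
bounded-witness : ∀ {m} {R : Rel (Fin m) 0ℓ} → Decidable R → (μ : ∀ {i j} → R i j → ℕ) →
                  Σ ℕ λ M → ∀ {i j} → R i j → Σ (R i j) λ r → μ r ≤ M
bounded-witness {m} {R} R? μ = M , witness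
  where
  μ? : Fin m → Fin m → ℕ
  μ? i j with R? i j
  ... | yes r = μ r
  ... | no _  = 0

  M : ℕ
  M = max 0 (tabulate λ i → max 0 (tabulate (μ? i)))

  μ?≤M : ∀ i j → μ? i j ≤ M
  μ?≤M i j = ≤-trans (All.tabulate⁻ (xs≤max 0 (tabulate (μ? i))) j)
                     (All.tabulate⁻ (xs≤max 0 _) i)

  witness : ∀ {i j} → R i j → Σ (R i j) λ r → μ r ≤ M
  witness {i} {j} r with R? i j | μ?≤M i j
  ... | yes r' | μr'≤M = r' , μr'≤M
  ... | no ¬r  | _     = contradiction r ¬r

productColouring : ∀ {m n} r → (Fin r → Fin m → Fin n) → Fin m → Fin (n ^ r)
productColouring zero    c i = zero
productColouring (suc r) c i = combine (c zero i) (productColouring r (c ∘ suc) i)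

productColouring-injective : ∀ {m n} r (c : Fin r → Fin m → Fin n) {i j} →
  productColouring r c i ≡ productColouring r c j → ∀ ℓ → c ℓ i ≡ c ℓ j
productColouring-injective (suc r) c {i} {j} eq ℓ
  with combine-injective (c zero i) (productColouring r (c ∘ suc) i)
                         (c zero j) (productColouring r (c ∘ suc) j) eq
productColouring-injective (suc r) c eq zero    | c₀ , _    = c₀
productColouring-injective (suc r) c eq (suc ℓ) | _  , rest =
  productColouring-injective r (c ∘ suc) rest ℓ

common-monochromatic-pair : ∀ {m n} r (c : Fin r → Fin m → Fin n) → n ^ r < m →
  ∃₂ λ i j → i ≢ j × ∀ ℓ → c ℓ i ≡ c ℓ j
common-monochromatic-pair r c nʳ<m with pigeonhole nʳ<m (productColouring r c)
... | i , j , i<j , eq = i , j , <⇒≢ i<j , productColouring-injective r c eq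

pair : ℕ → ℕ → Baire
pair i j zero    = i
pair i j (suc _) = j

module _ {m n} (p : Baire) (hp : PHP'Inst m n p) where

  limit : Fin m → ℕ
  limit i = proj₁ (proj₂ hp (toℕ i) (toℕ<n i))

  limit-isLimit : ∀ i → LimIs m p (toℕ i) (limit i)
  limit-isLimit i = proj₂ (proj₂ hp (toℕ i) (toℕ<n i))

  limit<n : ∀ i → limit i < n
  limit<n i = let s₀ , lim = limit-isLimit i in
    subst (_< n) (lim s₀ ≤-refl) (proj₁ hp s₀ (toℕ i) (toℕ<n i))

  limitColouring : Fin m → Fin n
  limitColouring i = fromℕ< (limit<n i)

  monochromatic⇒solution : ∀ {i j} → i ≢ j → limitColouring i ≡ limitColouring j →
    PHP'Sol m n p hp (pair (toℕ i) (toℕ j))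
  monochromatic⇒solution {i} {j} i≢j same =
    toℕ<n i , toℕ<n j , i≢j ∘ toℕ-injective , limit i , limit-isLimit i ,
    subst (LimIs m p (toℕ j)) (sym (fromℕ<-injective _ _ (limit<n i) (limit<n j) same))
      (limit-isLimit j)

module _ (k : ℕ) where

  switch : ℕ → ℕ → Baire
  switch M a t with t <? M
  ... | yes _ = k
  ... | no _  = a

  switch-agrees : ∀ M a → Agree M (const k) (switch M a)
  switch-agrees M a t t<M with t <? M
  ... | yes _   = refl
  ... | no t≮M = contradiction t<M t≮M

  switch-inst : ∀ M {a} → a < k → ACCInst k (switch M a)
  switch-inst M {a} a<k = inj₁ (a , a<k , (M , switch-at-M) , only-a)
    where
    switch-at-M : switch M a M ≡ a
    switch-at-M with M <? M
    ... | yes M<M = contradiction M<M (<-irrefl refl)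
    ... | no _    = refl

    only-a : ∀ j → j < k → Appears j (switch M a) → j ≡ a
    only-a j j<k (t , eq) with t <? M
    ... | yes _ = contradiction (subst (_< k) (sym eq) j<k) (<-irrefl refl)
    ... | no _  = sym eq

module Refutation {k m n} (R : ACC k ≤W* PHP' m n) where
  open _≤W*_ R

  colour : (x : Baire) → ACCInst k x → Fin m → Fin n
  colour x hx = limitColouring (Φ x hx) (Φ-inst x hx)

  x₀ : Baire
  x₀ = const k

  x₀-inst : ACCInst k x₀
  x₀-inst = inj₂ (λ _ → refl)

  Monochromatic₀ : Rel (Fin m) 0ℓ
  Monochromatic₀ i j = i ≢ j × colour x₀ x₀-inst i ≡ colour x₀ x₀-inst j

  monochromatic₀? : Decidable Monochromatic₀
  monochromatic₀? i j = ¬? (i ≟ᶠ j) ×-dec (colour x₀ x₀-inst i ≟ᶠ colour x₀ x₀-inst j)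

  solution₀ : ∀ {i j} → Monochromatic₀ i j →
    PHP'Sol m n (Φ x₀ x₀-inst) (Φ-inst x₀ x₀-inst) (pair (toℕ i) (toℕ j))
  solution₀ (i≢j , same) =
    monochromatic⇒solution (Φ x₀ x₀-inst) (Φ-inst x₀ x₀-inst) i≢j same

  modulus : ∀ {i j} → Monochromatic₀ i j → ℕ
  modulus {i} {j} s = proj₁ (Ψ-cont x₀ x₀-inst (pair (toℕ i) (toℕ j)) (solution₀ s) 1)

  M : ℕ
  M = proj₁ (bounded-witness monochromatic₀? modulus)

  x : Fin k → Baire
  x a = switch k M (toℕ a)

  x-inst : ∀ a → ACCInst k (x a)
  x-inst a = switch-inst k M (toℕ<n a)

  colours : Fin (suc k) → Fin m → Fin n
  colours zero    = colour x₀ x₀-inst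
  colours (suc a) = colour (x a) (x-inst a)

  no-common-monochromatic-pair : ∀ {i j} → i ≢ j → (∀ ℓ → colours ℓ i ≡ colours ℓ j) → ⊥
  no-common-monochromatic-pair {i} {j} i≢j same =
    contradiction answer-a (proj₂ (Ψ-sol (x a) (x-inst a) q solution-a))
    where
    q : Baire
    q = pair (toℕ i) (toℕ j)

    bounded : Σ (Monochromatic₀ i j) λ s → modulus s ≤ M
    bounded = proj₂ (bounded-witness monochromatic₀? modulus) (i≢j , same zero)

    s : Monochromatic₀ i j
    s = proj₁ bounded

    a<k : Ψ x₀ x₀-inst q (solution₀ s) 0 < k
    a<k = Ψ-sol x₀ x₀-inst q (solution₀ s)

    a : Fin k
    a = fromℕ< a<k

    solution-a : PHP'Sol m n (Φ (x a) (x-inst a)) (Φ-inst (x a) (x-inst a)) q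
    solution-a =
      monochromatic⇒solution (Φ (x a) (x-inst a)) (Φ-inst (x a) (x-inst a)) i≢j (same (suc a))

    answer-a : Ψ (x a) (x-inst a) q solution-a 0 ≡ toℕ a
    answer-a = trans
      (sym (proj₂ (Ψ-cont x₀ x₀-inst q (solution₀ s) 1) (x a) (x-inst a) q solution-a
                  (Agree-≤ (proj₂ bounded) (switch-agrees k M (toℕ a))) (λ _ _ → refl) 0 z<s))
      (sym (toℕ-fromℕ< a<k))

ACC≰PHP' : ∀ {k m n} → n ^ suc k < m → ¬ (ACC k ≤W* PHP' m n)
ACC≰PHP' {k} nᵏ⁺¹<m R =
  let open Refutation R
      _ , _ , i≢j , same = common-monochromatic-pair (suc k) colours nᵏ⁺¹<m
  in no-common-monochromatic-pair i≢j same

proposition3p14 : (k n : ℕ) → 2 ≤ k → 2 ≤ n →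
    ¬ (ACC k ≤W* PHP' (n ^ (k + 1) + 1) n)
proposition3p14 k n _ _ =
  ACC≰PHP' (subst (λ e → n ^ e < n ^ (k + 1) + 1) (+-comm k 1) (m<m+n (n ^ (k + 1)) z<s))
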